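{- Let $G$ be a connected graph of order at least two and let $H$ be any graph with exactly $i_{H}$ isolated vertices. Then $$\chi_{i}(G\circ H)\leq \chi_{2}(G)|V(H)|-i_{H}\big(\chi_{2}(G)-\chi_{i}(G)\big).$$ Moreover, if $H$ has no isolated vertices, then $$\chi_{i}(G\circ H)=\chi_{2}(G\circ H)\geq(\Delta(G)+1)|V(H)|.$$
   Context: All graphs are finite and simple. An injective $k$-coloring of a graph $G$ is a function $f:V(G)\to\{1,\dots,k\}$ such that no vertex is adjacent to two distinct vertices $u,w$ with $f(u)=f(w)$; $\chi_i(G)$, the injective chromatic number, is the minimum such $k$. A 2-distance coloring of $G$ assigns colors to vertices so that any two distinct vertices at distance at most two receive different colors; $\chi_2(G)$ is the minimum number of colors in such a coloring. $\Delta(G)$ is the maximum degree. The lexicographic product $G\circ H$ has vertex set $V(G)\times V(H)$, with $(g,h)$ and $(g',h')$ adjacent iff $gg'\in E(G)$, or $g=g'$ and $hh'\in E(H)$. -}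

module Defs where

open import Data.Nat using (ℕ; zero; suc; _+_; _*_; _≤_; _⊔_)
open import Data.Fin using (Fin; _≟_; remQuot)
open import Data.Bool using (Bool; true; false; T; not; _∧_; _∨_)
open import Data.List using (List; length; filterᵇ; map; foldr)
open import Data.List.Base using (allFin)
open import Data.Product using (Σ; ∃; _×_; _,_)
open import Data.Sum using (_⊎_)
open import Relation.Nullary using (¬_; does)
open import Relation.Binary.PropositionalEquality using (_≡_; _≢_)

record Graph : Set where
  field
    order : ℕ
    adj   : Fin order → Fin order → Bool

open Graph public

Adj : (G : Graph) → Fin (order G) → Fin (order G) → Set
Adj G u v = T (adj G u v)

IsSimple : Graph → Set
IsSimple G = (∀ u v → adj G u v ≡ adj G v u) × (∀ v → adj G v v ≡ false)

data Reach (G : Graph) : Fin (order G) → Fin (order G) → Set where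
  here : ∀ {v} → Reach G v v
  step : ∀ {u v w} → Adj G u v → Reach G v w → Reach G u w

Connected : Graph → Set
Connected G = ∀ u v → Reach G u v

degree : (G : Graph) → Fin (order G) → ℕ
degree G v = length (filterᵇ (adj G v) (allFin (order G)))

Δ : Graph → ℕ
Δ G = foldr _⊔_ 0 (map (degree G) (allFin (order G)))

isolated? : (G : Graph) → Fin (order G) → Bool
isolated? G v = foldr (λ w r → not (adj G v w) ∧ r) true (allFin (order G))

numIsolated : Graph → ℕ
numIsolated G = length (filterᵇ (isolated? G) (allFin (order G)))

-- lexicographic product; vertex (g , h) is encoded by combine g h ∈ Fin (|G| * |H|)
_∘ₗ_ : Graph → Graph → Graph
G ∘ₗ H = record
  { order = order G * order H
  ; adj   = λ x y → lexAdj (remQuot (order H) x) (remQuot (order H) y)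
  }
  where
  lexAdj : Fin (order G) × Fin (order H) → Fin (order G) × Fin (order H) → Bool
  lexAdj (g , h) (g′ , h′) = adj G g g′ ∨ (does (g ≟ g′) ∧ adj H h h′)

IsInjectiveColoring : (G : Graph) (k : ℕ) → (Fin (order G) → Fin k) → Set
IsInjectiveColoring G k f =
  ∀ v u w → Adj G v u → Adj G v w → u ≢ w → f u ≢ f w

IsTwoDistanceColoring : (G : Graph) (k : ℕ) → (Fin (order G) → Fin k) → Set
IsTwoDistanceColoring G k f =
  ∀ u w → u ≢ w → (Adj G u w ⊎ ∃ λ v → Adj G u v × Adj G v w) → f u ≢ f w

IsInjectiveChromaticNumber : Graph → ℕ → Set
IsInjectiveChromaticNumber G k =
  (∃ λ f → IsInjectiveColoring G k f) ×
  (∀ m → (∃ λ f → IsInjectiveColoring G m f) → k ≤ m)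

IsTwoDistanceChromaticNumber : Graph → ℕ → Set
IsTwoDistanceChromaticNumber G k =
  (∃ λ f → IsTwoDistanceColoring G k f) ×
  (∀ m → (∃ λ f → IsTwoDistanceColoring G m f) → k ≤ m)

module Submission where

-- Colour the vertex (g , h) of G ∘ H from a palette private to the layer h: by an optimal injective
-- colouring of G when h is isolated in H, and by an optimal 2-distance colouring of G otherwise.
-- Two neighbours of (g′ , h′) inside one layer have G-coordinates in the closed neighbourhood of g′,
-- hence within distance two in G; if the layer is isolated in H they are even both neighbours of g′.
-- Summing the palettes gives χ₂ |V(H)| − i_H (χ₂ − χ_i) colours.  When H has no isolated vertex,
-- every edge of G ∘ H lies in a triangle, so injective and 2-distance colourings of G ∘ H coincide,
-- and N[v] × V(H) for v of maximum degree is a set of (Δ + 1) |V(H)| vertices pairwise within distance two.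

open import Defs
open import Data.Nat using (ℕ; zero; suc; _+_; _*_; _∸_; _≤_; _<_; s≤s; z≤n)
open import Data.Nat.Properties
  using (≤-trans; ≤-reflexive; ≤-antisym; ⊔-sel; +-assoc; +-comm; *-suc; *-zeroʳ; *-monoˡ-≤;
         m+n∸n≡m; m+[n∸m]≡n; +-0-monoid; +-commutativeSemigroup)
open import Data.Fin using (Fin; zero; suc; _≟_; _↑ˡ_; _↑ʳ_; remQuot; combine; fromℕ<)
open import Data.Fin.Properties
  using (↑ˡ-injective; ↑ʳ-injective; suc-injective; remQuot-combine; combine-remQuot; combine-injective;
         injective⇒≤)
open import Data.Bool using (Bool; true; false; T; not; _∧_; if_then_else_)
open import Data.Bool.Properties using (T-∨; T-∧; T?)
open import Data.List using (List; []; _∷_; length; filterᵇ; foldr; map; lookup; tabulate)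
open import Data.List.Base using (allFin)
open import Data.List.Relation.Unary.All as All using (All; []; _∷_)
open import Data.List.Relation.Unary.All.Properties using (all-filter)
open import Data.List.Relation.Unary.Any using (Any; here; there; satisfied)
open import Data.List.Membership.Propositional using (_∈_)
open import Data.List.Membership.Propositional.Properties
  using (∈-allFin; ∈-lookup; ∈-filter⁻; ∈-map⁻; foldr-selective)
open import Data.List.Relation.Unary.AllPairs using (_∷_)
open import Data.List.Relation.Unary.Unique.Propositional using (Unique)
open import Data.List.Relation.Unary.Unique.Propositional.Properties using (allFin⁺; filter⁺)
open import Data.Product using (∃; _×_; _,_; proj₁; proj₂; uncurry)
open import Data.Sum using (_⊎_; inj₁; inj₂)
open import Function using (_∘_; id; Injective)
open import Function.Bundles using (Equivalence)
open import Relation.Nullary using (¬_; yes; no; contradiction)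
open import Relation.Nullary.Decidable using (dec-true)
open import Relation.Binary.PropositionalEquality
  using (_≡_; _≢_; refl; sym; trans; cong; cong₂; subst; module ≡-Reasoning)
open import Algebra.Properties.Monoid.Sum +-0-monoid using (sum)
open import Algebra.Properties.CommutativeSemigroup +-commutativeSemigroup using (interchange)

open Equivalence using (to; from)

↑ˡ≢↑ʳ : ∀ {m n} (i : Fin m) (j : Fin n) → i ↑ˡ n ≢ m ↑ʳ j
↑ˡ≢↑ʳ zero    j ()
↑ˡ≢↑ʳ (suc i) j eq = ↑ˡ≢↑ʳ i j (suc-injective eq)

inject : ∀ {n} (w : Fin n → ℕ) (h : Fin n) → Fin (w h) → Fin (sum w)
inject {suc n} w zero    x = x ↑ˡ sum (w ∘ suc)
inject {suc n} w (suc h) x = w zero ↑ʳ inject (w ∘ suc) h x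

-- Phrased through a section c so that the second component can be compared within one block.
inject-injective : ∀ {n} {X : Set} (w : Fin n → ℕ) (c : (h : Fin n) → X → Fin (w h)) {h h′ x x′} →
  inject w h (c h x) ≡ inject w h′ (c h′ x′) → h ≡ h′ × c h x ≡ c h x′
inject-injective {suc n} w c {zero}  {zero}   eq = refl , ↑ˡ-injective _ _ _ eq
inject-injective {suc n} w c {zero}  {suc _}  eq = contradiction eq (↑ˡ≢↑ʳ _ _)
inject-injective {suc n} w c {suc _} {zero}   eq = contradiction (sym eq) (↑ˡ≢↑ʳ _ _)
inject-injective {suc n} w c {suc h} {suc h′} eq
  with refl , same ← inject-injective (w ∘ suc) (c ∘ suc) (↑ʳ-injective (w zero) _ _ eq) = refl , same

sum-if≡ : ∀ {A : Set} {a b n} (p : A → Bool) (f : Fin n → A) → a ≤ b →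
  sum (λ i → if p (f i) then a else b) ≡ b * n ∸ length (filterᵇ p (tabulate f)) * (b ∸ a)
sum-if≡ {A} {a} {b} p f a≤b = begin
  weights f                                         ≡⟨ m+n∸n≡m (weights f) (count f * (b ∸ a)) ⟨
  weights f + count f * (b ∸ a) ∸ count f * (b ∸ a) ≡⟨ cong (_∸ count f * (b ∸ a)) (sum+count f) ⟩
  b * _ ∸ count f * (b ∸ a)                         ∎
  where
  open ≡-Reasoning
  weights : ∀ {n} → (Fin n → A) → ℕ
  weights f = sum (λ i → if p (f i) then a else b)
  count : ∀ {n} → (Fin n → A) → ℕ
  count f = length (filterᵇ p (tabulate f))
  sum+count : ∀ {n} (f : Fin n → A) → weights f + count f * (b ∸ a) ≡ b * n
  sum+count {zero}  f = sym (*-zeroʳ b)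
  sum+count {suc n} f with p (f zero) | sum+count (f ∘ suc)
  ... | true  | ih = begin
    a + weights (f ∘ suc) + (b ∸ a + count (f ∘ suc) * (b ∸ a))
      ≡⟨ interchange a _ (b ∸ a) _ ⟩
    a + (b ∸ a) + (weights (f ∘ suc) + count (f ∘ suc) * (b ∸ a))
      ≡⟨ cong₂ _+_ (m+[n∸m]≡n a≤b) ih ⟩
    b + b * n
      ≡⟨ *-suc b n ⟨
    b * suc n ∎
  ... | false | ih = begin
    b + weights (f ∘ suc) + count (f ∘ suc) * (b ∸ a)   ≡⟨ +-assoc b _ _ ⟩
    b + (weights (f ∘ suc) + count (f ∘ suc) * (b ∸ a)) ≡⟨ cong (b +_) ih ⟩
    b + b * n                                           ≡⟨ *-suc b n ⟨
    b * suc n                                           ∎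

lookup-injective : ∀ {A : Set} {xs : List A} → Unique xs → Injective _≡_ _≡_ (lookup xs)
lookup-injective {xs = _ ∷ _} _             {zero}  {zero}  _  = refl
lookup-injective {xs = _ ∷ _} (x∉xs ∷ _)    {zero}  {suc j} eq =
  contradiction eq (All.lookup x∉xs (∈-lookup j))
lookup-injective {xs = _ ∷ _} (x∉xs ∷ _)    {suc i} {zero}  eq =
  contradiction (sym eq) (All.lookup x∉xs (∈-lookup i))
lookup-injective {xs = _ ∷ _} (_ ∷ unique) {suc i} {suc j} eq = cong suc (lookup-injective unique eq)

module _ {A : Set} (q : A → Bool) where

  noneᵇ : List A → Bool
  noneᵇ = foldr (λ x r → not (q x) ∧ r) true

  noneᵇ-true : ∀ xs → noneᵇ xs ≡ true → All (λ x → q x ≡ false) xs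
  noneᵇ-true []       _ = []
  noneᵇ-true (x ∷ xs) e with q x in qx
  ... | false = qx ∷ noneᵇ-true xs e

  noneᵇ-false : ∀ xs → noneᵇ xs ≡ false → Any (λ x → q x ≡ true) xs
  noneᵇ-false (x ∷ xs) e with q x in qx
  ... | true  = here qx
  ... | false = there (noneᵇ-false xs e)

count≡0⇒false : ∀ {A : Set} (p : A → Bool) {xs x} → length (filterᵇ p xs) ≡ 0 → x ∈ xs → p x ≡ false
count≡0⇒false p {y ∷ _} e (here refl) with p y
... | false = refl
count≡0⇒false p {y ∷ _} e (there x∈xs) with p y
... | false = count≡0⇒false p e x∈xs

∃-other : ∀ {n} → 2 ≤ n → (i : Fin n) → ∃ (i ≢_)
∃-other (s≤s (s≤s z≤n)) zero    = suc zero , λ ()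
∃-other (s≤s (s≤s z≤n)) (suc _) = zero , λ ()

SymmetricAdj : Graph → Set
SymmetricAdj G = ∀ {u v} → Adj G u v → Adj G v u

NoIsolatedVertex : Graph → Set
NoIsolatedVertex G = ∀ v → ∃ (Adj G v)

EveryEdgeInTriangle : Graph → Set
EveryEdgeInTriangle G = ∀ {u w} → Adj G u w → ∃ λ v → Adj G v u × Adj G v w

simple⇒symmetric : ∀ {G} → IsSimple G → SymmetricAdj G
simple⇒symmetric (sym-adj , _) {u} {v} = subst T (sym-adj u v)

WithinTwo : (G : Graph) → Fin (order G) → Fin (order G) → Set
WithinTwo G u w = Adj G u w ⊎ ∃ λ v → Adj G u v × Adj G v w

ClosedNbhd : (G : Graph) → Fin (order G) → Fin (order G) → Set
ClosedNbhd G v u = v ≡ u ⊎ Adj G v u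

module _ {G : Graph} where

  closedNbhd-withinTwo : SymmetricAdj G → ∀ {v u w} →
    ClosedNbhd G v u → ClosedNbhd G v w → u ≢ w → WithinTwo G u w
  closedNbhd-withinTwo sym-adj (inj₁ refl) (inj₁ refl) u≢w = contradiction refl u≢w
  closedNbhd-withinTwo sym-adj (inj₁ refl) (inj₂ vw)   _   = inj₁ vw
  closedNbhd-withinTwo sym-adj (inj₂ vu)   (inj₁ refl) _   = inj₁ (sym-adj vu)
  closedNbhd-withinTwo sym-adj (inj₂ vu)   (inj₂ vw)   _   = inj₂ (_ , sym-adj vu , vw)

  twoDistance⇒injective : SymmetricAdj G → ∀ {k f} → IsTwoDistanceColoring G k f → IsInjectiveColoring G k f
  twoDistance⇒injective sym-adj f-2d v u w vu vw u≢w = f-2d u w u≢w (inj₂ (v , sym-adj vu , vw))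

  injective⇒twoDistance : SymmetricAdj G → EveryEdgeInTriangle G →
    ∀ {k f} → IsInjectiveColoring G k f → IsTwoDistanceColoring G k f
  injective⇒twoDistance sym-adj triangle f-inj u w u≢w (inj₁ uw)
    with v , vu , vw ← triangle uw = f-inj v u w vu vw u≢w
  injective⇒twoDistance sym-adj triangle f-inj u w u≢w (inj₂ (v , uv , vw)) = f-inj v u w (sym-adj uv) vw u≢w

  χi≤χ2 : SymmetricAdj G → ∀ {a b} →
    IsInjectiveChromaticNumber G a → IsTwoDistanceChromaticNumber G b → a ≤ b
  χi≤χ2 sym-adj (_ , a-min) ((f , f-2d) , _) = a-min _ (f , twoDistance⇒injective sym-adj f-2d)

  χi≡χ2 : SymmetricAdj G → EveryEdgeInTriangle G →
    ∀ {a b} → IsInjectiveChromaticNumber G a → IsTwoDistanceChromaticNumber G b → a ≡ b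
  χi≡χ2 sym-adj triangle χi@((f , f-inj) , _) χ2@(_ , b-min) =
    ≤-antisym (χi≤χ2 sym-adj χi χ2) (b-min _ (f , injective⇒twoDistance sym-adj triangle f-inj))

  twoDistance-clique-bound : ∀ {k m f} → IsTwoDistanceColoring G k f →
    (e : Fin m → Fin (order G)) → Injective _≡_ _≡_ e → (∀ x y → WithinTwo G (e x) (e y)) → m ≤ k
  twoDistance-clique-bound {f = f} f-2d e e-inj close = injective⇒≤ f∘e-injective
    where
    f∘e-injective : Injective _≡_ _≡_ (f ∘ e)
    f∘e-injective {x} {y} same with x ≟ y
    ... | yes x≡y = x≡y
    ... | no x≢y  = contradiction same (f-2d (e x) (e y) (x≢y ∘ e-inj) (close x y))

  isolated⇒¬adj : ∀ {v w} → isolated? G v ≡ true → ¬ Adj G v w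
  isolated⇒¬adj {v} {w} iso =
    subst T (All.lookup (noneᵇ-true (adj G v) (allFin (order G)) iso) (∈-allFin w))

  ¬isolated⇒adj : ∀ {v} → isolated? G v ≡ false → ∃ (Adj G v)
  ¬isolated⇒adj {v} not-iso
    with w , vw ← satisfied (noneᵇ-false (adj G v) (allFin (order G)) not-iso) = w , subst T (sym vw) _

  numIsolated≡0⇒noIsolatedVertex : numIsolated G ≡ 0 → NoIsolatedVertex G
  numIsolated≡0⇒noIsolatedVertex none v = ¬isolated⇒adj (count≡0⇒false (isolated? G) none (∈-allFin v))

  connected⇒noIsolatedVertex : Connected G → 2 ≤ order G → NoIsolatedVertex G
  connected⇒noIsolatedVertex connected two v with w , v≢w ← ∃-other two v | connected v w
  ... | here      = contradiction refl v≢w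
  ... | step vu _ = _ , vu

  ∃-degree≥Δ : Fin (order G) → ∃ λ v → Δ G ≤ degree G v
  ∃-degree≥Δ v with foldr-selective ⊔-sel 0 (map (degree G) (allFin (order G)))
  ... | inj₁ Δ≡0 = v , ≤-trans (≤-reflexive Δ≡0) z≤n
  ... | inj₂ Δ∈  with w , _ , Δ≡deg ← ∈-map⁻ (degree G) Δ∈ = w , ≤-reflexive Δ≡deg

  closedNbhdList : Fin (order G) → List (Fin (order G))
  closedNbhdList v = v ∷ filterᵇ (adj G v) (allFin (order G))

  closedNbhdList-unique : IsSimple G → ∀ v → Unique (closedNbhdList v)
  closedNbhdList-unique (_ , loopless) v =
    All.map adj⇒≢ (all-filter (T? ∘ adj G v) (allFin (order G)))
      ∷ filter⁺ (T? ∘ adj G v) (allFin⁺ (order G))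
    where
    adj⇒≢ : ∀ {w} → Adj G v w → v ≢ w
    adj⇒≢ vw refl = subst T (loopless v) vw

  closedNbhdList-sound : ∀ {v u} → u ∈ closedNbhdList v → ClosedNbhd G v u
  closedNbhdList-sound     (here u≡v)  = inj₁ (sym u≡v)
  closedNbhdList-sound {v} (there u∈N) =
    inj₂ (proj₂ (∈-filter⁻ (T? ∘ adj G v) {xs = allFin (order G)} u∈N))

  closedNbhdList-withinTwo : SymmetricAdj G → ∀ v i j →
    lookup (closedNbhdList v) i ≢ lookup (closedNbhdList v) j →
    WithinTwo G (lookup (closedNbhdList v) i) (lookup (closedNbhdList v) j)
  closedNbhdList-withinTwo sym-adj v i j =
    closedNbhd-withinTwo sym-adj (closedNbhdList-sound (∈-lookup i)) (closedNbhdList-sound (∈-lookup j))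

module LexProduct (G H : Graph) where

  π₁ : Fin (order (G ∘ₗ H)) → Fin (order G)
  π₁ x = proj₁ (remQuot {order G} (order H) x)

  π₂ : Fin (order (G ∘ₗ H)) → Fin (order H)
  π₂ x = proj₂ (remQuot {order G} (order H) x)

  π₁-combine : ∀ {g} {h : Fin (order H)} → π₁ (combine g h) ≡ g
  π₁-combine {g} {h} = cong proj₁ (remQuot-combine g h)

  π₂-combine : ∀ {g : Fin (order G)} {h} → π₂ (combine g h) ≡ h
  π₂-combine {g} {h} = cong proj₂ (remQuot-combine g h)

  π-injective : ∀ {x y} → π₁ x ≡ π₁ y → π₂ x ≡ π₂ y → x ≡ y
  π-injective {x} {y} e₁ e₂ = begin
    x                    ≡⟨ combine-remQuot {order G} (order H) x ⟨
    combine (π₁ x) (π₂ x) ≡⟨ cong₂ combine e₁ e₂ ⟩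
    combine (π₁ y) (π₂ y) ≡⟨ combine-remQuot {order G} (order H) y ⟩
    y                    ∎
    where open ≡-Reasoning

  adj-lift : ∀ {x y} → Adj G (π₁ x) (π₁ y) → Adj (G ∘ₗ H) x y
  adj-lift a = from T-∨ (inj₁ a)

  adj-layer : ∀ {x y} → π₁ x ≡ π₁ y → Adj H (π₂ x) (π₂ y) → Adj (G ∘ₗ H) x y
  adj-layer {x} {y} e a = from T-∨ (inj₂ (from T-∧ (subst T (sym (dec-true (π₁ x ≟ π₁ y) e)) _ , a)))

  adj-cases : ∀ {x y} → Adj (G ∘ₗ H) x y →
    Adj G (π₁ x) (π₁ y) ⊎ (π₁ x ≡ π₁ y × Adj H (π₂ x) (π₂ y))
  adj-cases {x} {y} xy with to T-∨ xy
  ... | inj₁ a = inj₁ a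
  ... | inj₂ b with π₁ x ≟ π₁ y
  ...   | yes same = inj₂ (same , b)

  adj⇒closedNbhd : ∀ {x y} → Adj (G ∘ₗ H) x y → ClosedNbhd G (π₁ x) (π₁ y)
  adj⇒closedNbhd xy with adj-cases xy
  ... | inj₁ a       = inj₂ a
  ... | inj₂ (e , _) = inj₁ e

  adj-combineˡ : ∀ {g h y} → Adj G g (π₁ y) → Adj (G ∘ₗ H) (combine g h) y
  adj-combineˡ a = adj-lift (subst (λ g → Adj G g _) (sym π₁-combine) a)

  adj-combine : ∀ {g g′ h h′} → Adj G g g′ → Adj (G ∘ₗ H) (combine g h) (combine g′ h′)
  adj-combine a = adj-combineˡ (subst (Adj G _) (sym π₁-combine) a)

  module _ (sym-G : SymmetricAdj G) (sym-H : SymmetricAdj H) where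

    lex-symmetric : SymmetricAdj (G ∘ₗ H)
    lex-symmetric xy with adj-cases xy
    ... | inj₁ a       = adj-lift (sym-G a)
    ... | inj₂ (e , a) = adj-layer (sym e) (sym-H a)

    lex-everyEdgeInTriangle : NoIsolatedVertex G → NoIsolatedVertex H → EveryEdgeInTriangle (G ∘ₗ H)
    lex-everyEdgeInTriangle nbr-G nbr-H {x} xy with adj-cases xy
    ... | inj₁ a with h , a′ ← nbr-H (π₂ x) =
      combine (π₁ x) h ,
      adj-layer π₁-combine (subst (λ h → Adj H h _) (sym π₂-combine) (sym-H a′)) ,
      adj-combineˡ a
    ... | inj₂ (e , _) with g , a′ ← nbr-G (π₁ x) =
      combine g (π₂ x) , adj-combineˡ (sym-G a′) , adj-combineˡ (subst (Adj G g) e (sym-G a′))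

  withinTwo-combine : SymmetricAdj G → NoIsolatedVertex G →
    ∀ {g g′ h h′} → g ≡ g′ ⊎ WithinTwo G g g′ →
    WithinTwo (G ∘ₗ H) (combine g h) (combine g′ h′)
  withinTwo-combine sym-G nbr-G {g} {h = h} (inj₁ refl) with g″ , a ← nbr-G g =
    inj₂ (combine g″ h , adj-combine a , adj-combine (sym-G a))
  withinTwo-combine sym-G nbr-G (inj₂ (inj₁ a)) = inj₁ (adj-combine a)
  withinTwo-combine sym-G nbr-G {h = h} (inj₂ (inj₂ (g″ , a , a′))) =
    inj₂ (combine g″ h , adj-combine a , adj-combine a′)

  lex-twoDistance-clique-bound : SymmetricAdj G → NoIsolatedVertex G →
    ∀ {k f} → IsTwoDistanceColoring (G ∘ₗ H) k f →
    ∀ {m} (s : Fin m → Fin (order G)) → Injective _≡_ _≡_ s →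
    (∀ i j → s i ≢ s j → WithinTwo G (s i) (s j)) → m * order H ≤ k
  lex-twoDistance-clique-bound sym-G nbr-G f-2d {m} s s-injective s-close =
    twoDistance-clique-bound f-2d e e-injective close
    where
    coords : Fin (m * order H) → Fin m × Fin (order H)
    coords = remQuot {m} (order H)

    e : Fin (m * order H) → Fin (order (G ∘ₗ H))
    e x = combine (s (proj₁ (coords x))) (proj₂ (coords x))

    e-injective : Injective _≡_ _≡_ e
    e-injective {x} {y} eq with same-s , same-h ← combine-injective _ _ _ _ eq = begin
      x                       ≡⟨ combine-remQuot {m} (order H) x ⟨
      uncurry combine (coords x) ≡⟨ cong₂ combine (s-injective same-s) same-h ⟩
      uncurry combine (coords y) ≡⟨ combine-remQuot {m} (order H) y ⟩
      y                       ∎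
      where open ≡-Reasoning

    close : ∀ x y → WithinTwo (G ∘ₗ H) (e x) (e y)
    close x y with s (proj₁ (coords x)) ≟ s (proj₁ (coords y))
    ... | yes same = withinTwo-combine sym-G nbr-G (inj₁ same)
    ... | no  diff = withinTwo-combine sym-G nbr-G (inj₂ (s-close _ _ diff))

  module LayerColouring (sym-G : SymmetricAdj G) (sym-H : SymmetricAdj H)
    {a b} (fi : Fin (order G) → Fin a) (f2 : Fin (order G) → Fin b)
    (fi-injective : IsInjectiveColoring G a fi) (f2-twoDistance : IsTwoDistanceColoring G b f2) where

    palette : Fin (order H) → ℕ
    palette h = if isolated? H h then a else b

    colour : (β : Bool) → Fin (order G) → Fin (if β then a else b)
    colour true  = fi
    colour false = f2

    lexColouring : Fin (order (G ∘ₗ H)) → Fin (sum palette)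
    lexColouring x = inject palette (π₂ x) (colour (isolated? H (π₂ x)) (π₁ x))

    adj-isolated-layer : ∀ {v u} → isolated? H (π₂ u) ≡ true →
      Adj (G ∘ₗ H) v u → Adj G (π₁ v) (π₁ u)
    adj-isolated-layer iso vu with adj-cases vu
    ... | inj₁ a       = a
    ... | inj₂ (_ , a) = contradiction (sym-H a) (isolated⇒¬adj {G = H} iso)

    colour-separates : ∀ {v u u′} → Adj (G ∘ₗ H) v u → Adj (G ∘ₗ H) v u′ →
      π₁ u ≢ π₁ u′ → π₂ u ≡ π₂ u′ →
      colour (isolated? H (π₂ u)) (π₁ u) ≢ colour (isolated? H (π₂ u)) (π₁ u′)
    colour-separates {v} {u} {u′} vu vu′ diff same with isolated? H (π₂ u) in iso
    ... | true  = fi-injective (π₁ v) (π₁ u) (π₁ u′) (adj-isolated-layer iso vu)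
                    (adj-isolated-layer (trans (cong (isolated? H) (sym same)) iso) vu′) diff
    ... | false = f2-twoDistance (π₁ u) (π₁ u′) diff
                    (closedNbhd-withinTwo sym-G (adj⇒closedNbhd vu) (adj⇒closedNbhd vu′) diff)

    lexColouring-injective : IsInjectiveColoring (G ∘ₗ H) (sum palette) lexColouring
    lexColouring-injective v u u′ vu vu′ u≢u′ eq
      with same-layer , same-colour ← inject-injective palette (λ h → colour (isolated? H h)) eq =
      colour-separates vu vu′ (λ same-g → u≢u′ (π-injective same-g same-layer)) same-layer same-colour

  lex-twoDistance-Δ-bound : IsSimple G → NoIsolatedVertex G → 0 < order G →
    ∀ {k f} → IsTwoDistanceColoring (G ∘ₗ H) k f → (Δ G + 1) * order H ≤ k
  lex-twoDistance-Δ-bound simple-G nbr-G nonempty f-2d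
    with v , Δ≤deg ← ∃-degree≥Δ {G} (fromℕ< nonempty) =
    ≤-trans (*-monoˡ-≤ (order H) (≤-trans (≤-reflexive (+-comm (Δ G) 1)) (s≤s Δ≤deg)))
      (lex-twoDistance-clique-bound sym-G nbr-G f-2d (lookup (closedNbhdList {G} v))
        (lookup-injective (closedNbhdList-unique simple-G v)) (closedNbhdList-withinTwo sym-G v))
    where sym-G = simple⇒symmetric simple-G

theorem3p1 : (G H : Graph) → IsSimple G → IsSimple H →
    Connected G → 2 ≤ order G →
    (a b c : ℕ) →
    IsInjectiveChromaticNumber G a →
    IsTwoDistanceChromaticNumber G b →
    IsInjectiveChromaticNumber (G ∘ₗ H) c →
    (c ≤ b * order H ∸ numIsolated H * (b ∸ a))
    × (numIsolated H ≡ 0 → (d : ℕ) → IsTwoDistanceChromaticNumber (G ∘ₗ H) d →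
        (c ≡ d) × ((Δ G + 1) * order H ≤ d))
theorem3p1 G H simple-G simple-H connected two a b c
  χi-G@((fi , fi-injective) , _) χ2-G@((f2 , f2-twoDistance) , _) χi-GH@(_ , c-minimal) = upper-bound , without-isolated
  where
  open LexProduct G H
  sym-G = simple⇒symmetric simple-G
  sym-H = simple⇒symmetric simple-H
  nbr-G = connected⇒noIsolatedVertex connected two
  open LayerColouring sym-G sym-H fi f2 fi-injective f2-twoDistance

  upper-bound : c ≤ b * order H ∸ numIsolated H * (b ∸ a)
  upper-bound = ≤-trans (c-minimal _ (lexColouring , lexColouring-injective))
    (≤-reflexive (sum-if≡ (isolated? H) id (χi≤χ2 sym-G χi-G χ2-G)))

  without-isolated : numIsolated H ≡ 0 → (d : ℕ) → IsTwoDistanceChromaticNumber (G ∘ₗ H) d →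
    (c ≡ d) × ((Δ G + 1) * order H ≤ d)
  without-isolated none d χ2-GH@((_ , f-twoDistance) , _) =
    χi≡χ2 (lex-symmetric sym-G sym-H) (lex-everyEdgeInTriangle sym-G sym-H nbr-G nbr-H) χi-GH χ2-GH ,
    lex-twoDistance-Δ-bound simple-G nbr-G (≤-trans (s≤s z≤n) two) f-twoDistance
    where nbr-H = numIsolated≡0⇒noIsolatedVertex none
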